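{- Let $G$ be a simple connected graph that is not a path. Then $md(G)\ge 3$ (where $md(G)=\infty$ is allowed).
   Context: For vertices $u,v$ of a connected graph $G$, $d(u,v)$ is the length of a shortest $u$–$v$ path. For $W\subseteq V(G)$ and $v\in V(G)$, $r_m(v|W)$ is the multiset $\{d(v,w): w\in W\}$. $W$ is an m-resolving set if $r_m(u|W)\neq r_m(v|W)$ for all distinct $u,v\in V(G)$. If $G$ has an m-resolving set, $md(G)$ is the minimum cardinality of one; otherwise $md(G)=\infty$. -}

module Defs where

open import Data.Nat using (ℕ; zero; suc)
open import Data.Bool using (Bool; true; false; _∧_; if_then_else_)
open import Data.Fin using (Fin; toℕ; _≟_)
open import Data.List using (List; allFin; map)
open import Data.Bool.ListAction using (any)
open import Data.List.Relation.Binary.Permutation.Propositional using (_↭_)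
open import Data.Product using (Σ; ∃; _×_)
open import Data.Sum using (_⊎_)
open import Relation.Binary.PropositionalEquality using (_≡_; _≢_)
open import Relation.Nullary using (¬_; does)
open import Function using (_⇔_)
open import Function.Definitions using (Injective)

record Graph : Set where
  field
    n      : ℕ
    adj    : Fin n → Fin n → Bool
    sym    : ∀ u v → adj u v ≡ adj v u
    irrefl : ∀ u → adj u u ≡ false

open Graph public

walkᵇ : (G : Graph) → ℕ → Fin (n G) → Fin (n G) → Bool
walkᵇ G zero    u v = does (u ≟ v)
walkᵇ G (suc k) u v = any (λ w → adj G u w ∧ walkᵇ G k w v) (allFin (n G))

Connected : Graph → Set
Connected G = ∀ u v → ∃ λ k → walkᵇ G k u v ≡ true

-- Least k < bound with a walk of length k from u to v, searching from `start`;
-- returns start + bound if none exists.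
searchDist : (G : Graph) → Fin (n G) → Fin (n G) → ℕ → ℕ → ℕ
searchDist G u v start zero        = start
searchDist G u v start (suc bound) =
  if walkᵇ G start u v then start else searchDist G u v (suc start) bound

-- d(u,v): the length of a shortest u–v walk (= length of a shortest u–v path).
-- In a connected graph on n vertices this is < n, so searching 0..n-1 suffices.
dist : (G : Graph) → Fin (n G) → Fin (n G) → ℕ
dist G u v = searchDist G u v 0 (n G)

-- r_m(v | W): the multiset of distances from v to the elements of W,
-- represented as a list taken up to permutation.
rm : (G : Graph) → Fin (n G) → List (Fin (n G)) → List ℕ
rm G v W = map (dist G v) W

MResolving : (G : Graph) → List (Fin (n G)) → Set
MResolving G W = ∀ u v → u ≢ v → ¬ (rm G u W ↭ rm G v W)

-- G is a path: its vertices can be ordered v_0, …, v_{n-1} (f injective, hence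
-- a bijection of Fin n) so that v_i ~ v_j exactly when |i - j| = 1.
IsPath : Graph → Set
IsPath G = Σ (Fin (n G) → Fin (n G)) λ f → Injective _≡_ _≡_ f ×
  (∀ i j → (adj G (f i) (f j) ≡ true) ⇔ (toℕ i ≡ suc (toℕ j) ⊎ toℕ j ≡ suc (toℕ i)))

module Submission where

-- An m-resolving set W must separate any two distinct vertices, so it
-- suffices to rule out |W| ≤ 2:
--   * |W| = 0: every vertex has the empty multiset, so all vertices are
--     equal, and such a graph is a (trivial) path.
--   * |W| = 2, W = {a, b}: both a and b see the multiset {0, d(a,b)}.
--   * |W| = 1, W = {w}: the distance to w is injective on vertices.  Every
--     vertex at distance k+1 from w has a neighbour at distance k, so the
--     occupied distances form an initial segment {0, …, n-1}, each occupied
--     by exactly one vertex, and two vertices are adjacent exactly when their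
--     distances differ by one: G is the path listed in order of distance.

open import Defs
open import Data.Nat using (ℕ; zero; suc; _≤_; _<_; _+_; z≤n; s≤s)
import Data.Nat.Properties as ℕP
open import Data.Bool using (true; false; _∧_)
open import Data.Bool.Properties using (T-≡; T-∧; ⇔→≡)
open import Data.List using (List; []; _∷_; length; allFin)
open import Data.List.Membership.Propositional using (lose)
open import Data.List.Membership.Propositional.Properties using (∈-allFin)
open import Data.List.Relation.Unary.Any using (satisfied)
open import Data.List.Relation.Unary.Any.Properties using (any⁺; any⁻)
open import Data.List.Relation.Unary.All using ([]; _∷_)
open import Data.List.Relation.Unary.AllPairs using (_∷_)
open import Data.List.Relation.Unary.Unique.Propositional using (Unique)
open import Data.List.Relation.Binary.Permutation.Propositional using (_↭_; ↭-refl; ↭-reflexive; ↭-swap)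
open import Data.Fin using (Fin; toℕ; fromℕ<; _≟_)
import Data.Fin.Properties as FinP
open import Data.Product using (∃; _×_; _,_; proj₁; proj₂)
open import Data.Sum using (_⊎_; inj₁; inj₂)
open import Relation.Binary.PropositionalEquality as ≡ using (_≡_; _≢_; refl; trans; cong; subst; subst₂)
open import Relation.Binary.Definitions using (tri<; tri≈; tri>)
open import Relation.Nullary using (¬_; yes; no; contradiction)
open import Relation.Nullary.Decidable using (toWitness; isYes≗does; dec-true; decidable-stable)
open import Function using (_⇔_; Equivalence; mk⇔; id; _∘_)
open import Function.Definitions using (Injective)

loop-free : (G : Graph) (u : Fin (n G)) → adj G u u ≢ true
loop-free G u u~u with trans (≡.sym u~u) (irrefl G u)
... | ()

module Walks (G : Graph) where

  private variable
    k : ℕ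
    u v x : Fin (n G)

  -- "There is a walk of length k from u to v", wrapped in a record so that
  -- k, u and v can be inferred from it.
  record Walk (k : ℕ) (u v : Fin (n G)) : Set where
    constructor walk
    field found : walkᵇ G k u v ≡ true

  open Walk public

  walk-zero⁻ : Walk 0 u v → u ≡ v
  walk-zero⁻ {u} {v} (walk h) =
    toWitness {a? = u ≟ v} (Equivalence.from T-≡ (trans (isYes≗does (u ≟ v)) h))

  walk-zero⁺ : Walk 0 u u
  walk-zero⁺ {u} = walk (dec-true (u ≟ u) refl)

  walk-suc⁻ : Walk (suc k) u v → ∃ λ x → adj G u x ≡ true × Walk k x v
  walk-suc⁻ {k} {u} {v} (walk h) =
    let x , t = satisfied (any⁻ (λ y → adj G u y ∧ walkᵇ G k y v) (allFin _) (Equivalence.from T-≡ h))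
        a , b = Equivalence.to T-∧ t
    in x , Equivalence.to T-≡ a , walk (Equivalence.to T-≡ b)

  walk-suc⁺ : adj G u x ≡ true → Walk k x v → Walk (suc k) u v
  walk-suc⁺ {u} {x} {k} {v} a (walk b) = walk (Equivalence.to T-≡
    (any⁺ (λ y → adj G u y ∧ walkᵇ G k y v)
      (lose (∈-allFin x) (Equivalence.from T-∧ (Equivalence.from T-≡ a , Equivalence.from T-≡ b)))))

  walk-snoc : Walk k u x → adj G x v ≡ true → Walk (suc k) u v
  walk-snoc {k = zero} {u} {x} u⇝x x~v with refl ← walk-zero⁻ {u = u} {v = x} u⇝x =
    walk-suc⁺ x~v walk-zero⁺
  walk-snoc {k = suc k} u⇝x x~v with y , u~y , y⇝x ← walk-suc⁻ u⇝x =
    walk-suc⁺ u~y (walk-snoc y⇝x x~v)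

  walk-reverse : Walk k u v → Walk k v u
  walk-reverse {k = zero} {u} {v} u⇝v with refl ← walk-zero⁻ {u = u} {v = v} u⇝v = walk-zero⁺
  walk-reverse {k = suc k} {u} u⇝v with x , u~x , x⇝v ← walk-suc⁻ u⇝v =
    walk-snoc (walk-reverse x⇝v) (trans (sym G x u) u~x)

  connected-walk : Connected G → ∀ u v → ∃ λ k → Walk k u v
  connected-walk connected u v with k , h ← connected u v = k , walk h

  walkᵇ-sym : ∀ k u v → walkᵇ G k u v ≡ walkᵇ G k v u
  walkᵇ-sym k u v = ⇔→≡ (mk⇔ (reversed u v) (reversed v u))
    where
    reversed : ∀ u v → walkᵇ G k u v ≡ true → walkᵇ G k v u ≡ true
    reversed u v h = found (walk-reverse (walk {k} {u} {v} h))

module Distances (G : Graph) where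

  open Walks G

  private variable
    k m : ℕ
    u v w x : Fin (n G)

  search-outcome : ∀ u v s b →
    (Walk (searchDist G u v s b) u v × searchDist G u v s b < s + b) ⊎ searchDist G u v s b ≡ s + b
  search-outcome u v s zero = inj₂ (≡.sym (ℕP.+-identityʳ s))
  search-outcome u v s (suc b) rewrite ℕP.+-suc s b with walkᵇ G s u v in hit
  ... | true  = inj₁ (walk hit , s≤s (ℕP.m≤m+n s b))
  ... | false = search-outcome u v (suc s) b

  search-least : ∀ s b → s ≤ m → m < s + b → Walk m u v → searchDist G u v s b ≤ m
  search-least s zero s≤m m<s+0 _ = contradiction s≤m (ℕP.<⇒≱ (subst (_ <_) (ℕP.+-identityʳ s) m<s+0))
  search-least {m} {u} {v} s (suc b) s≤m m<s+b u⇝v rewrite ℕP.+-suc s b with walkᵇ G s u v in hit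
  ... | true  = s≤m
  ... | false with ℕP.m≤n⇒m<n∨m≡n s≤m
  ...   | inj₁ s<m  = search-least (suc s) b s<m m<s+b u⇝v
  ...   | inj₂ refl with () ← trans (≡.sym (found u⇝v)) hit

  dist-outcome : ∀ u v → (Walk (dist G u v) u v × dist G u v < n G) ⊎ dist G u v ≡ n G
  dist-outcome u v = search-outcome u v 0 (n G)

  dist≤n : ∀ u v → dist G u v ≤ n G
  dist≤n u v with dist-outcome u v
  ... | inj₁ (_ , d<n) = ℕP.<⇒≤ d<n
  ... | inj₂ d≡n       = ℕP.≤-reflexive d≡n

  dist-least : Walk m u v → dist G u v ≤ m
  dist-least {m} {u} {v} u⇝v with m ℕP.<? n G
  ... | yes m<n = search-least 0 (n G) z≤n m<n u⇝v
  ... | no  m≮n = ℕP.≤-trans (dist≤n u v) (ℕP.≮⇒≥ m≮n)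

  dist-self : ∀ w → dist G w w ≡ 0
  dist-self w = ℕP.n≤0⇒n≡0 (dist-least walk-zero⁺)

  dist-sym : ∀ u v → dist G u v ≡ dist G v u
  dist-sym u v = search-sym 0 (n G)
    where
    search-sym : ∀ s b → searchDist G u v s b ≡ searchDist G v u s b
    search-sym s zero = refl
    search-sym s (suc b) rewrite walkᵇ-sym s u v | search-sym (suc s) b = refl

  dist-neighbour : adj G u x ≡ true → dist G u w ≤ suc (dist G x w)
  dist-neighbour {u} {x} {w} u~x with dist-outcome x w
  ... | inj₁ (x⇝w , _) = dist-least (walk-suc⁺ u~x x⇝w)
  ... | inj₂ d≡n       =
    ℕP.≤-trans (dist≤n u w) (ℕP.≤-trans (ℕP.≤-reflexive (≡.sym d≡n)) (ℕP.n≤1+n _))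

  neighbour-level : adj G v x ≡ true → dist G v w ≡ suc k → dist G x w ≤ k → dist G x w ≡ k
  neighbour-level v~x d≡k+1 dx≤k =
    ℕP.≤-antisym dx≤k (ℕP.≤-pred (subst (_≤ _) d≡k+1 (dist-neighbour v~x)))

  closer-neighbour : Walk (suc k) v w → dist G v w ≡ suc k →
    ∃ λ x → adj G v x ≡ true × dist G x w ≡ k
  closer-neighbour v⇝w d≡k+1 with x , v~x , x⇝w ← walk-suc⁻ v⇝w =
    x , v~x , neighbour-level v~x d≡k+1 (dist-least x⇝w)

module SingleResolver (G : Graph) (connected : Connected G) (w : Fin (n G))
    (D-injective : ∀ u v → dist G u w ≡ dist G v w → u ≡ v) where

  open Walks G
  open Distances G

  private variable
    k m : ℕ
    u v : Fin (n G)

  D : Fin (n G) → ℕ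
  D v = dist G v w

  neighbours-differ : adj G u v ≡ true → D u ≢ D v
  neighbours-differ {u} {v} u~v Du≡Dv with refl ← D-injective u v Du≡Dv = loop-free G u u~v

  -- If the
  -- search in dist found no walk, D v = n; then the first step of any walk
  -- to w leads to a neighbour at distance ≥ n - 1 and ≠ n, i.e. n - 1.
  descend : D v ≡ suc k → ∃ λ x → adj G v x ≡ true × D x ≡ k
  descend {v} {k} Dv≡k+1 with dist-outcome v w
  ... | inj₁ (v⇝w , _) = closer-neighbour (subst (λ d → Walk d v w) Dv≡k+1 v⇝w) Dv≡k+1
  ... | inj₂ Dv≡n with connected-walk connected v w
  ...   | zero , v⇝w with refl ← walk-zero⁻ v⇝w with () ← trans (≡.sym Dv≡k+1) (dist-self v)
  ...   | suc _ , v⇝w with x , v~x , _ ← walk-suc⁻ v⇝w =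
    x , v~x , neighbour-level v~x Dv≡k+1 (ℕP.m<1+n⇒m≤n (ℕP.≤∧≢⇒< Dx≤k+1 Dx≢k+1))
    where
    Dx≤k+1 : D x ≤ suc k
    Dx≤k+1 = subst (D x ≤_) (trans (≡.sym Dv≡n) Dv≡k+1) (dist≤n x w)
    Dx≢k+1 : D x ≢ suc k
    Dx≢k+1 Dx≡k+1 = neighbours-differ v~x (trans Dv≡k+1 (≡.sym Dx≡k+1))

  Occupied : ℕ → Set
  Occupied i = ∃ λ x → D x ≡ i

  occupied-below : Occupied m → ∀ i → i ≤ m → Occupied i
  occupied-below {zero}  occ       .zero z≤n = occ
  occupied-below {suc m} (v , Dv≡m+1) i i≤m+1 with ℕP.m≤n⇒m<n∨m≡n i≤m+1
  ... | inj₂ refl     = v , Dv≡m+1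
  ... | inj₁ (s≤s i≤m) with x , _ , Dx≡m ← descend Dv≡m+1 = occupied-below (x , Dx≡m) i i≤m

  labelled-injective : (f : Fin m → Fin (n G)) → (∀ i → D (f i) ≡ toℕ i) → Injective _≡_ _≡_ f
  labelled-injective f Df≡ {i} {j} fi≡fj =
    FinP.toℕ-injective (trans (≡.sym (Df≡ i)) (trans (cong D fi≡fj) (Df≡ j)))

  occupied-bound : (∀ (i : Fin m) → Occupied (toℕ i)) → m ≤ n G
  occupied-bound occ = FinP.injective⇒≤ (labelled-injective (proj₁ ∘ occ) (proj₂ ∘ occ))

  -- Hence no vertex is at distance n (that would occupy n + 1 distances).
  D<n : ∀ v → D v < n G
  D<n v with ℕP.m≤n⇒m<n∨m≡n (dist≤n v w)
  ... | inj₁ Dv<n = Dv<n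
  ... | inj₂ Dv≡n = contradiction (occupied-bound {suc (n G)} all-occupied) ℕP.1+n≰n
    where
    all-occupied : ∀ (i : Fin (suc (n G))) → Occupied (toℕ i)
    all-occupied i = occupied-below (v , Dv≡n) (toℕ i) (FinP.toℕ≤pred[n] i)

  D-index : Fin (n G) → Fin (n G)
  D-index v = fromℕ< (D<n v)

  D-index-injective : Injective _≡_ _≡_ D-index
  D-index-injective {u} {v} eq = D-injective u v
    (trans (≡.sym (FinP.toℕ-fromℕ< (D<n u))) (trans (cong toℕ eq) (FinP.toℕ-fromℕ< (D<n v))))

  -- Conversely every distance i < n is occupied: the injective map D-index
  -- on Fin n takes some value ≥ i, and occupied sets are downward closed.
  every-level-occupied : ∀ (i : Fin (n G)) → Occupied (toℕ i)
  every-level-occupied i with j , _ , i≤Dj ← FinP.injective⇒existsPivot D-index-injective i =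
    occupied-below (j , refl) (toℕ i) (subst (toℕ i ≤_) (FinP.toℕ-fromℕ< (D<n j)) i≤Dj)

  adjacent⇔consecutive : ∀ u v → adj G u v ≡ true ⇔ (D u ≡ suc (D v) ⊎ D v ≡ suc (D u))
  adjacent⇔consecutive u v = mk⇔ consecutive adjacent
    where
    consecutive : adj G u v ≡ true → D u ≡ suc (D v) ⊎ D v ≡ suc (D u)
    consecutive u~v with ℕP.<-cmp (D u) (D v)
    ... | tri< Du<Dv _ _ = inj₂ (ℕP.≤-antisym (dist-neighbour (trans (sym G v u) u~v)) Du<Dv)
    ... | tri≈ _ Du≡Dv _ = contradiction Du≡Dv (neighbours-differ u~v)
    ... | tri> _ _ Du>Dv = inj₁ (ℕP.≤-antisym (dist-neighbour u~v) Du>Dv)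

    below : ∀ x y → D x ≡ suc (D y) → adj G x y ≡ true
    below x y Dx≡Dy+1 with z , x~z , Dz≡Dy ← descend Dx≡Dy+1 with refl ← D-injective z y Dz≡Dy = x~z

    adjacent : D u ≡ suc (D v) ⊎ D v ≡ suc (D u) → adj G u v ≡ true
    adjacent (inj₁ Du≡Dv+1) = below u v Du≡Dv+1
    adjacent (inj₂ Dv≡Du+1) = trans (sym G u v) (below v u Dv≡Du+1)

  is-path : IsPath G
  is-path = level , labelled-injective level D-level , λ i j →
    subst₂ (λ a b → (adj G (level i) (level j) ≡ true) ⇔ (a ≡ suc b ⊎ b ≡ suc a))
      (D-level i) (D-level j) (adjacent⇔consecutive (level i) (level j))
    where
    level : Fin (n G) → Fin (n G)
    level = proj₁ ∘ every-level-occupied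
    D-level : ∀ i → D (level i) ≡ toℕ i
    D-level = proj₂ ∘ every-level-occupied

all-equal⇒path : (G : Graph) → (∀ (u v : Fin (n G)) → u ≡ v) → IsPath G
all-equal⇒path G all-equal = id , id , λ i j → mk⇔ (no-edge i j) (no-successor i j)
  where
  no-edge : ∀ i j → adj G i j ≡ true → toℕ i ≡ suc (toℕ j) ⊎ toℕ j ≡ suc (toℕ i)
  no-edge i j i~j with refl ← all-equal i j = contradiction i~j (loop-free G i)

  no-successor : ∀ i j → toℕ i ≡ suc (toℕ j) ⊎ toℕ j ≡ suc (toℕ i) → adj G i j ≡ true
  no-successor i j steps with refl ← all-equal i j with steps
  ... | inj₁ i≡i+1 = contradiction (≡.sym i≡i+1) ℕP.1+n≢n
  ... | inj₂ i≡i+1 = contradiction (≡.sym i≡i+1) ℕP.1+n≢n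

resolving-separates : (G : Graph) {W : List (Fin (n G))} → MResolving G W →
  ∀ u v → rm G u W ↭ rm G v W → u ≡ v
resolving-separates G resolving u v same = decidable-stable (u ≟ v) (λ u≢v → resolving u v u≢v same)

-- The case |W| = 2: both elements of {a, b} see the multiset {0, d(a,b)}.
pair-unresolved : (G : Graph) (a b : Fin (n G)) → rm G a (a ∷ b ∷ []) ↭ rm G b (a ∷ b ∷ [])
pair-unresolved G a b
  rewrite Distances.dist-self G a | Distances.dist-self G b | Distances.dist-sym G a b =
  ↭-swap 0 (dist G b a) ↭-refl

theorem2p7 : (G : Graph) → Connected G → ¬ IsPath G →
    (W : List (Fin (n G))) → Unique W → MResolving G W → 3 ≤ length W
theorem2p7 G _ not-path [] _ resolving =
  contradiction (all-equal⇒path G (λ u v → resolving-separates G resolving u v ↭-refl)) not-path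
theorem2p7 G connected not-path (w ∷ []) _ resolving =
  contradiction (SingleResolver.is-path G connected w distance-injective) not-path
  where
  distance-injective : ∀ u v → dist G u w ≡ dist G v w → u ≡ v
  distance-injective u v eq = resolving-separates G resolving u v (↭-reflexive (cong (_∷ []) eq))
theorem2p7 G _ _ (a ∷ b ∷ []) ((a≢b ∷ []) ∷ _) resolving =
  contradiction (resolving-separates G resolving a b (pair-unresolved G a b)) a≢b
theorem2p7 _ _ _ (_ ∷ _ ∷ _ ∷ _) _ _ = s≤s (s≤s (s≤s z≤n))
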